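{- Let $\langle G,k,\mathsf{init},\mathsf{fin}\rangle$ be an instance of Snake Game. Let $\mathsf{conf}_1=(u_1,\dots,u_k)$ and $\mathsf{conf}_2=(a_1,\dots,a_k)$ be two $(G,k)$-configurations. Let $P=(v_1,\dots,v_\ell)$ be a simple path or a simple cycle in $G$ of size at least $k$ such that: $v_1=u_1$ and $v_\ell=a_k$; for every $2\le i\le k$ and $2\le j\le\ell$, $u_i\ne v_j$; and for every $1\le i\le k-1$ and $1\le j\le\ell-1$, $a_i\ne v_j$. Then $\mathsf{conf}_1$ can reach $\mathsf{conf}_2$.
   Context: For an undirected graph $G$ and $k\in\mathbb{N}$, a $(G,k)$-configuration is a tuple $(v_1,\dots,v_k)$ of pairwise distinct vertices with $\{v_i,v_{i+1}\}\in E(G)$ for $1\le i\le k-1$. A pair $((v_1,\dots,v_k),(v'_1,\dots,v'_k))$ is a $1$-transition if $v'_1\ne v_i$ for $1\le i\le k-1$ and $v'_i=v_{i-1}$ for $2\le i\le k$. $\mathsf{conf}$ can reach $\mathsf{conf}'$ if there exist configurations $\mathsf{conf}=\mathsf{c}_1,\dots,\mathsf{c}_{m+1}=\mathsf{conf}'$, $m\ge1$, with each consecutive pair a $1$-transition. An instance of Snake Game is $\langle G,k,\mathsf{init},\mathsf{fin}\rangle$ with $G$ undirected, $k\in\mathbb{N}$ and $\mathsf{init},\mathsf{fin}$ configurations. The size of a path or cycle is its number of vertices; in the cycle case $v_1=v_\ell$. -}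

module Defs where

open import Data.Nat using (ℕ; zero; suc; _≤_)
open import Data.Fin using (Fin; zero; suc; inject₁; fromℕ)
open import Data.Product using (_×_)
open import Data.Sum using (_⊎_)
open import Relation.Binary.PropositionalEquality using (_≡_; _≢_)
open import Relation.Nullary using (¬_)
open import Level using (0ℓ) renaming (suc to lsuc)

record Graph : Set₁ where
  field
    n     : ℕ
    Adj   : Fin n → Fin n → Set
    sym   : ∀ {x y} → Adj x y → Adj y x
    irrefl : ∀ {x} → ¬ Adj x x

open Graph public

Vertex : Graph → Set
Vertex G = Fin (n G)

-- A k-tuple of vertices, with k = suc m (0-based indices: position i ↦ v_{i+1}).
Tuple : Graph → ℕ → Set
Tuple G k = Fin k → Vertex G

record IsConf (G : Graph) (m : ℕ) (c : Tuple G (suc m)) : Set where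
  field
    distinct : ∀ i j → c i ≡ c j → i ≡ j
    adjacent : ∀ (i : Fin m) → Adj G (c (inject₁ i)) (c (suc i))

record Transition (G : Graph) (m : ℕ) (c c' : Tuple G (suc m)) : Set where
  field
    conf-src : IsConf G m c
    conf-tgt : IsConf G m c'
    head-new : ∀ (i : Fin m) → c' zero ≢ c (inject₁ i)
    shift    : ∀ (i : Fin m) → c' (suc i) ≡ c (inject₁ i)

data CanReach (G : Graph) (m : ℕ) : Tuple G (suc m) → Tuple G (suc m) → Set where
  one  : ∀ {c c'} → Transition G m c c' → CanReach G m c c'
  more : ∀ {c c' c''} → Transition G m c c' → CanReach G m c' c'' → CanReach G m c c''

record IsSimplePath (G : Graph) (p : ℕ) (v : Fin (suc p) → Vertex G) : Set where
  field
    distinct : ∀ i j → v i ≡ v j → i ≡ j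
    adjacent : ∀ (j : Fin p) → Adj G (v (inject₁ j)) (v (suc j))

record IsSimpleCycle (G : Graph) (p : ℕ) (v : Fin (suc p) → Vertex G) : Set where
  field
    closed   : v zero ≡ v (fromℕ p)
    distinct : ∀ (i j : Fin p) → v (inject₁ i) ≡ v (inject₁ j) → i ≡ j
    adjacent : ∀ (j : Fin p) → Adj G (v (inject₁ j)) (v (suc j))
    three    : 3 ≤ p

-- Size = number of vertices: ℓ for a path, ℓ - 1 (distinct vertices) for a cycle.
PathOrCycleOfSizeAtLeast : (G : Graph) (k p : ℕ) → (Fin (suc p) → Vertex G) → Set
PathOrCycleOfSizeAtLeast G k p v =
  (IsSimplePath G p v × k ≤ suc p) ⊎ (IsSimpleCycle G p v × k ≤ p)

module Submission where

-- Idea of the proof (k = m + 1).  Consider the "snake word"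
--
--     a₀ … a_{m-1}  v_p v_{p-1} … v₁  u₀ u₁ … u_m        (v_p = a_m, v₀ = u₀).
--
-- Its window of k letters at offset m + p is u, the one at offset 0 is a, and
-- shifting the window one letter to the left is a 1-transition: the head runs
-- along P from u₀ to v_p = a_m and then backwards along a.

open import Defs hiding (sym)
open import Data.Nat using (ℕ; zero; suc; _+_; _∸_; _≤_; _<_; z≤n; s≤s)
open import Data.Nat.Properties
open import Data.Fin using (Fin; zero; suc; toℕ; inject₁; fromℕ; fromℕ<; opposite)
open import Data.Fin.Properties
  using (toℕ-injective; toℕ-inject₁; toℕ-fromℕ; toℕ-fromℕ<; toℕ<n; opposite-prop;
         opposite-involutive; fromℕ≢inject₁; inject₁-injective)
  renaming (suc-injective to fin-suc-injective)
open import Data.Product using (_,_)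
open import Data.Sum using (_⊎_; inj₁; inj₂)
open import Data.Empty using (⊥-elim)
open import Relation.Binary.Definitions using (tri<; tri≈; tri>)
open import Relation.Binary.PropositionalEquality

at-same-index : ∀ {A : Set} {n} (f : Fin n → A) {i j : Fin n} → toℕ i ≡ toℕ j → f i ≡ f j
at-same-index f e = cong f (toℕ-injective e)

opposite-sum : ∀ {n} (j : Fin n) → suc (toℕ j + toℕ (opposite j)) ≡ n
opposite-sum {n} j = begin
  suc (toℕ j) + toℕ (opposite j)       ≡⟨ cong (suc (toℕ j) +_) (opposite-prop j) ⟩
  suc (toℕ j) + (n ∸ suc (toℕ j))     ≡⟨ m+[n∸m]≡n (toℕ<n j) ⟩
  n                                    ∎
  where open ≡-Reasoning

data LastOrInner {n : ℕ} : Fin (suc n) → Set where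
  last  : LastOrInner (fromℕ n)
  inner : (i : Fin n) → LastOrInner (inject₁ i)

lastOrInner : ∀ {n} (k : Fin (suc n)) → LastOrInner k
lastOrInner {zero}  zero    = last
lastOrInner {suc n} zero    = inner zero
lastOrInner {suc n} (suc k) with lastOrInner k
... | last    = last
... | inner i = inner (suc i)

infixr 5 _▸_
_▸_ : ∀ {A : Set} {n} → (Fin n → A) → (ℕ → A) → ℕ → A
_▸_ {n = zero}  f g x       = g x
_▸_ {n = suc n} f g zero    = f zero
_▸_ {n = suc n} f g (suc x) = ((λ i → f (suc i)) ▸ g) x

▸-here : ∀ {A : Set} {n} (f : Fin n → A) (g : ℕ → A) (i : Fin n) → (f ▸ g) (toℕ i) ≡ f i
▸-here f g zero    = refl
▸-here f g (suc i) = ▸-here (λ i → f (suc i)) g i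

▸-there : ∀ {A : Set} {n} (f : Fin n → A) (g : ℕ → A) (x : ℕ) → (f ▸ g) (n + x) ≡ g x
▸-there {n = zero}  f g x = refl
▸-there {n = suc n} f g x = ▸-there (λ i → f (suc i)) g x

data Split (n : ℕ) : ℕ → Set where
  here  : (i : Fin n) → Split n (toℕ i)
  there : (x : ℕ) → Split n (n + x)

split : ∀ n x → Split n x
split zero    x       = there x
split (suc n) zero    = here zero
split (suc n) (suc x) with split n x
... | here i  = here (suc i)
... | there y = there y

IsConf-resp : ∀ {G m c c'} → c ≗ c' → IsConf G m c → IsConf G m c'
IsConf-resp {G} c≗c' h = record
  { distinct = λ i j e → IsConf.distinct h i j (trans (c≗c' i) (trans e (sym (c≗c' j))))
  ; adjacent = λ i → subst₂ (Adj G) (c≗c' _) (c≗c' _) (IsConf.adjacent h i)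
  }

Transition-resp : ∀ {G m c₁ c₂ c₁' c₂'} → c₁ ≗ c₁' → c₂ ≗ c₂' →
                  Transition G m c₁ c₂ → Transition G m c₁' c₂'
Transition-resp c₁≗ c₂≗ t = record
  { conf-src = IsConf-resp c₁≗ (Transition.conf-src t)
  ; conf-tgt = IsConf-resp c₂≗ (Transition.conf-tgt t)
  ; head-new = λ i e → Transition.head-new t i (trans (c₂≗ _) (trans e (sym (c₁≗ _))))
  ; shift    = λ i → trans (sym (c₂≗ _)) (trans (Transition.shift t i) (c₁≗ _))
  }

CanReach-resp : ∀ {G m c₁ c₂ c₁' c₂'} → c₁ ≗ c₁' → c₂ ≗ c₂' →
                CanReach G m c₁ c₂ → CanReach G m c₁' c₂'
CanReach-resp c₁≗ c₂≗ (one t)    = one (Transition-resp c₁≗ c₂≗ t)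
CanReach-resp c₁≗ c₂≗ (more t r) =
  more (Transition-resp c₁≗ (λ _ → refl) t) (CanReach-resp (λ _ → refl) c₂≗ r)

single-vertex-move : ∀ {G c c'} → IsConf G 0 c → IsConf G 0 c' → CanReach G 0 c c'
single-vertex-move hc hc' =
  one (record { conf-src = hc ; conf-tgt = hc' ; head-new = λ () ; shift = λ () })

conf-consecutive : ∀ {G m c} → IsConf G m c →
                   ∀ (i i' : Fin (suc m)) → suc (toℕ i) ≡ toℕ i' → Adj G (c i) (c i')
conf-consecutive {G} {m} {c} hc i i' e with lastOrInner i
... | last     = ⊥-elim (<⇒≱ (toℕ<n i') (≤-reflexive (trans (cong suc (sym (toℕ-fromℕ m))) e)))
... | inner i₀ =
  subst (Adj G _) (at-same-index c (trans (cong suc (sym (toℕ-inject₁ i₀))) e))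
                  (IsConf.adjacent hc i₀)

window : (G : Graph) (m : ℕ) → (ℕ → Vertex G) → ℕ → Tuple G (suc m)
window G m W r i = W (r + toℕ i)

module Windows {G : Graph} {m : ℕ} (W : ℕ → Vertex G) (N : ℕ)
    (steps : ∀ x → x < N + m → Adj G (W x) (W (suc x)))
    (fresh : ∀ x y → x < y → y ≤ x + m → y ≤ N + m → W x ≢ W y) where

  window-conf : ∀ r → r ≤ N → IsConf G m (window G m W r)
  window-conf r r≤N = record { distinct = distinct ; adjacent = adjacent }
    where
    apart : ∀ (i j : Fin (suc m)) → toℕ i < toℕ j → W (r + toℕ i) ≢ W (r + toℕ j)
    apart i j i<j = fresh _ _ (+-monoʳ-< r i<j) near (+-mono-≤ r≤N j≤m)
      where
      j≤m : toℕ j ≤ m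
      j≤m = ≤-pred (toℕ<n j)
      near : r + toℕ j ≤ r + toℕ i + m
      near = ≤-trans (+-monoʳ-≤ r j≤m) (+-monoˡ-≤ m (m≤m+n r (toℕ i)))

    distinct : ∀ i j → window G m W r i ≡ window G m W r j → i ≡ j
    distinct i j e with <-cmp (toℕ i) (toℕ j)
    ... | tri< i<j _ _ = ⊥-elim (apart i j i<j e)
    ... | tri≈ _ i≡j _ = toℕ-injective i≡j
    ... | tri> _ _ j<i = ⊥-elim (apart j i j<i (sym e))

    adjacent : ∀ (i : Fin m) → Adj G (window G m W r (inject₁ i)) (window G m W r (suc i))
    adjacent i = subst₂ (Adj G) (cong (λ t → W (r + t)) (sym (toℕ-inject₁ i)))
                                (cong W (sym (+-suc r (toℕ i))))
                                (steps (r + toℕ i) (+-mono-≤-< r≤N (toℕ<n i)))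

  window-step : ∀ r → r < N → Transition G m (window G m W (suc r)) (window G m W r)
  window-step r r<N = record
    { conf-src = window-conf (suc r) r<N
    ; conf-tgt = target
    ; head-new = λ i e → 0≢suc (IsConf.distinct target zero (suc i) (trans e (sym (shift i))))
    ; shift    = shift
    }
    where
    target : IsConf G m (window G m W r)
    target = window-conf r (<⇒≤ r<N)

    shift : ∀ (i : Fin m) → window G m W r (suc i) ≡ window G m W (suc r) (inject₁ i)
    shift i = cong W (trans (+-suc r (toℕ i)) (cong (λ t → suc (r + t)) (sym (toℕ-inject₁ i))))

    0≢suc : ∀ {i : Fin m} → zero ≢ suc i
    0≢suc ()

  window-reach : ∀ r → 0 < r → r ≤ N → CanReach G m (window G m W r) (window G m W 0)
  window-reach zero          () _
  window-reach (suc zero)    _ r≤N = one (window-step zero r≤N)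
  window-reach (suc (suc r)) _ r≤N =
    more (window-step (suc r) r≤N) (window-reach (suc r) (s≤s z≤n) (<⇒≤ r≤N))

module _ {G : Graph} {p : ℕ} {v : Fin (suc p) → Vertex G} (C : IsSimpleCycle G p v) where
  open IsSimpleCycle C

  inner-start : ∀ (i : Fin p) → v zero ≡ v (inject₁ i) → inject₁ i ≡ zero
  inner-start zero    _ = refl
  inner-start (suc i) e with distinct zero (suc i) e
  ... | ()

  cycle-start-repeat : ∀ k → v zero ≡ v k → k ≡ zero ⊎ k ≡ fromℕ p
  cycle-start-repeat k e with lastOrInner k
  ... | last    = inj₂ refl
  ... | inner i = inj₁ (inner-start i e)

  cycle-injective : ∀ k k' → k ≢ zero → k' ≢ zero → v k ≡ v k' → k ≡ k'
  cycle-injective k k' k≢0 k'≢0 e with lastOrInner k | lastOrInner k'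
  ... | last    | last    = refl
  ... | last    | inner j = ⊥-elim (k'≢0 (inner-start j (trans closed e)))
  ... | inner i | last    = ⊥-elim (k≢0 (inner-start i (trans closed (sym e))))
  ... | inner i | inner j = cong inject₁ (distinct i j e)

module _ {G : Graph} {m p : ℕ} {v : Fin (suc p) → Vertex G} where

  Track : Set
  Track = PathOrCycleOfSizeAtLeast G (suc m) p v

  track-adjacent : Track → ∀ (j : Fin p) → Adj G (v (inject₁ j)) (v (suc j))
  track-adjacent (inj₁ (P , _)) = IsSimplePath.adjacent P
  track-adjacent (inj₂ (C , _)) = IsSimpleCycle.adjacent C

  track-long : Track → m ≤ p
  track-long (inj₁ (_ , k≤p+1)) = ≤-pred k≤p+1
  track-long (inj₂ (_ , k≤p))   = <⇒≤ k≤p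

  track-tail-injective : Track → ∀ (s t : Fin p) → v (suc s) ≡ v (suc t) → s ≡ t
  track-tail-injective (inj₁ (P , _)) s t e = fin-suc-injective (IsSimplePath.distinct P _ _ e)
  track-tail-injective (inj₂ (C , _)) s t e = fin-suc-injective (cycle-injective C _ _ (λ ()) (λ ()) e)

  -- the first vertex reappears only when closing a cycle, i.e. more than  m  steps later
  track-start-repeat : Track → ∀ (s : Fin p) → v zero ≡ v (suc s) → m < suc (toℕ s)
  track-start-repeat (inj₁ (P , _)) s e with IsSimplePath.distinct P _ _ e
  ... | ()
  track-start-repeat (inj₂ (C , k≤p)) s e with cycle-start-repeat C (suc s) e
  ... | inj₁ ()
  ... | inj₂ s+1≡p = subst (m <_) (trans (sym (toℕ-fromℕ p)) (cong toℕ (sym s+1≡p))) k≤p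

module SnakeWord {G : Graph} {m p : ℕ} {v : Fin (suc p) → Vertex G} {u a : Tuple G (suc m)}
    (0<m : 0 < m) (track : PathOrCycleOfSizeAtLeast G (suc m) p v)
    (hu : IsConf G m u) (ha : IsConf G m a)
    (start : v zero ≡ u zero) (end : v (fromℕ p) ≡ a (fromℕ m))
    (hU : ∀ (i : Fin m) (j : Fin p) → u (suc i) ≢ v (suc j))
    (hA : ∀ (i : Fin m) (j : Fin p) → a (inject₁ i) ≢ v (inject₁ j)) where

  V : Set
  V = Vertex G

  m≤p : m ≤ p
  m≤p = track-long track

  -- the blocks of the word:  a₀ … a_{m-1},  then the tail  v₁ … v_p  of the
  -- track read backwards ( back j = v_{p - j} ),  then  u  (padded with u₀)
  front : Fin m → V
  front i = a (inject₁ i)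

  back : Fin p → V
  back j = v (suc (opposite j))

  rear : ℕ → V
  rear = u ▸ λ _ → u zero

  word : ℕ → V
  word = front ▸ back ▸ rear

  data Block : ℕ → Set where
    inA : (i : Fin m) → Block (toℕ i)
    inB : (j : Fin p) → Block (m + toℕ j)
    inU : (i : Fin (suc m)) → Block (m + (p + toℕ i))

  block : ∀ x → x < m + (p + suc m) → Block x
  block x x<len with split m x
  ... | here i = inA i
  ... | there y with split p y
  ...   | here j = inB j
  ...   | there z with split (suc m) z
  ...     | here i  = inU i
  ...     | there w =
    ⊥-elim (<⇒≱ (+-cancelˡ-< p _ _ (+-cancelˡ-< m _ _ x<len)) (m≤m+n (suc m) w))

  value : ∀ {x} → Block x → V
  value (inA i) = a (inject₁ i)
  value (inB j) = back j
  value (inU i) = u i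

  word-value : ∀ {x} (b : Block x) → word x ≡ value b
  word-value (inA i) = ▸-here front (back ▸ rear) i
  word-value (inB j) = trans (▸-there front (back ▸ rear) (toℕ j)) (▸-here back rear j)
  word-value (inU i) = begin
    word (m + (p + toℕ i))     ≡⟨ ▸-there front (back ▸ rear) (p + toℕ i) ⟩
    (back ▸ rear) (p + toℕ i)  ≡⟨ ▸-there back rear (toℕ i) ⟩
    rear (toℕ i)               ≡⟨ ▸-here u _ i ⟩
    u i                        ∎
    where open ≡-Reasoning

  0<p : 0 < p
  0<p = <-≤-trans 0<m m≤p

  back-first : ∀ (j : Fin p) → toℕ j ≡ 0 → back j ≡ a (fromℕ m)
  back-first j j≡0 = trans (at-same-index v index) end
    where
    index : suc (toℕ (opposite j)) ≡ toℕ (fromℕ p)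
    index = trans (trans (cong (λ t → suc (t + toℕ (opposite j))) (sym j≡0)) (opposite-sum j))
                  (sym (toℕ-fromℕ p))

  front-then-back : ∀ (i : Fin m) (j : Fin p) → suc (toℕ i) ≡ m + toℕ j →
                    Adj G (a (inject₁ i)) (back j)
  front-then-back i j e =
    subst (Adj G _) (sym (trans (back-first j j≡0) (at-same-index a m≡i+1))) (IsConf.adjacent ha i)
    where
    j≡0 : toℕ j ≡ 0
    j≡0 = n≤0⇒n≡0 (+-cancelˡ-≤ m _ _ (subst₂ _≤_ e (sym (+-identityʳ m)) (toℕ<n i)))
    m≡i+1 : toℕ (fromℕ m) ≡ toℕ (suc i)
    m≡i+1 = trans (toℕ-fromℕ m) (sym (trans e (trans (cong (m +_) j≡0) (+-identityʳ m))))

  -- The front  a₀ … a_{m-1}  avoids the tail  v₁ … v_p  (recall  v_p = a_m).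
  front-avoids-tail : ∀ (i : Fin m) (s : Fin p) → a (inject₁ i) ≢ v (suc s)
  front-avoids-tail i s with suc s | lastOrInner (suc s)
  ... | _ | last    = λ e → fromℕ≢inject₁ (sym (IsConf.distinct ha _ _ (trans e end)))
  ... | _ | inner j = hA i j

  back-adjacent : ∀ (j : Fin p) → Adj G (back j) (v (inject₁ (opposite j)))
  back-adjacent j = Graph.sym G (track-adjacent track (opposite j))

  back-then-back : ∀ (j j' : Fin p) → suc (toℕ j) ≡ toℕ j' → Adj G (back j) (back j')
  back-then-back j j' e = subst (Adj G _) (at-same-index v index) (back-adjacent j)
    where
    open ≡-Reasoning
    index : toℕ (inject₁ (opposite j)) ≡ suc (toℕ (opposite j'))
    index = trans (toℕ-inject₁ _) (+-cancelˡ-≡ (suc (toℕ j)) _ _ (begin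
      suc (toℕ j) + toℕ (opposite j)          ≡⟨ opposite-sum j ⟩
      p                                       ≡⟨ sym (opposite-sum j') ⟩
      suc (toℕ j') + toℕ (opposite j')        ≡⟨ cong (λ t → suc (t + toℕ (opposite j'))) (sym e) ⟩
      suc (suc (toℕ j) + toℕ (opposite j'))   ≡⟨ sym (+-suc (suc (toℕ j)) _) ⟩
      suc (toℕ j) + suc (toℕ (opposite j'))   ∎))

  -- the last letter  v₁  of the reversed tail is followed by  u₀ = v₀
  back-then-rear : ∀ (j : Fin p) (i : Fin (suc m)) → suc (toℕ j) ≡ p + toℕ i →
                   Adj G (back j) (u i)
  back-then-rear j zero e = subst (Adj G _) (trans (at-same-index v index) start) (back-adjacent j)
    where
    index : toℕ (inject₁ (opposite j)) ≡ 0
    index = trans (toℕ-inject₁ _) (+-cancelˡ-≡ (suc (toℕ j)) _ 0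
              (trans (opposite-sum j) (sym (trans (+-identityʳ _) (trans e (+-identityʳ p))))))
  back-then-rear j (suc i) e = ⊥-elim (<⇒≱ (m<m+n p (s≤s z≤n)) (subst (_≤ p) e (toℕ<n j)))

  back-injective : ∀ (j j' : Fin p) → back j ≡ back j' → j ≡ j'
  back-injective j j' e = begin
    j                       ≡⟨ sym (opposite-involutive j) ⟩
    opposite (opposite j)   ≡⟨ cong opposite (track-tail-injective track _ _ e) ⟩
    opposite (opposite j')  ≡⟨ opposite-involutive j' ⟩
    j'                      ∎
    where open ≡-Reasoning

  start-far-from-back : ∀ (j : Fin p) → p ≤ toℕ j + m → v zero ≢ back j
  start-far-from-back j close e = <⇒≱ far close
    where
    far : toℕ j + m < p
    far = subst (toℕ j + m <_) (opposite-sum j)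
            (s≤s (+-monoʳ-≤ (toℕ j) (≤-pred (track-start-repeat track (opposite j) e))))

  values-differ : ∀ {x y} (bx : Block x) (by : Block y) → x < y → y ≤ x + m →
                  value bx ≢ value by
  values-differ (inA i) (inA i') x<y _ e =
    <-irrefl (cong toℕ (inject₁-injective (IsConf.distinct ha _ _ e))) x<y
  values-differ (inA i) (inB j) _ _ = front-avoids-tail i (opposite j)
  -- front and rear letters are more than  m  apart since  p ≥ m
  values-differ (inA i) (inU i') _ near _ =
    <⇒≱ (≤-trans (+-monoˡ-< m (toℕ<n i)) (+-monoʳ-≤ m m≤p))
        (≤-trans (+-monoʳ-≤ m (m≤m+n p _)) near)
  -- pairs listed in the wrong order contradict  x < y
  values-differ (inB j) (inA i) x<y _ _ = <⇒≱ x<y (≤-trans (<⇒≤ (toℕ<n i)) (m≤m+n m _))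
  values-differ (inB j) (inB j') x<y _ e =
    <-irrefl (cong (λ k → m + toℕ k) (back-injective j j' e)) x<y
  values-differ (inB j) (inU zero) _ near e = start-far-from-back j close (trans start (sym e))
    where
    close : p ≤ toℕ j + m
    close = +-cancelˡ-≤ m _ _ (subst₂ _≤_ (cong (m +_) (+-identityʳ p)) (+-assoc m (toℕ j) m) near)
  values-differ (inB j) (inU (suc i)) _ _ e = hU i (opposite j) (sym e)
  values-differ (inU i) (inA i') x<y _ _ = <⇒≱ x<y (≤-trans (<⇒≤ (toℕ<n i')) (m≤m+n m _))
  values-differ (inU i) (inB j) x<y _ _ =
    <⇒≱ x<y (+-monoʳ-≤ m (≤-trans (<⇒≤ (toℕ<n j)) (m≤m+n p _)))
  values-differ (inU i) (inU i') x<y _ e =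
    <-irrefl (cong (λ k → m + (p + toℕ k)) (IsConf.distinct hu _ _ e)) x<y

  values-adjacent : ∀ {x y} (bx : Block x) (by : Block y) → suc x ≡ y →
                    Adj G (value bx) (value by)
  values-adjacent (inA i) (inA i') e =
    subst (Adj G _) (at-same-index a (trans e (sym (toℕ-inject₁ i')))) (IsConf.adjacent ha i)
  values-adjacent (inA i) (inB j) e = front-then-back i j e
  -- the remaining pairs of blocks are never consecutive (using  p > 0)
  values-adjacent (inA i) (inU i') e =
    ⊥-elim (<⇒≱ (<-≤-trans (m<m+n m 0<p) (+-monoʳ-≤ m (m≤m+n p _)))
                (subst (_≤ m) e (toℕ<n i)))
  values-adjacent (inB j) (inA i) e =
    ⊥-elim (<⇒≱ (toℕ<n i) (subst (m ≤_) e (≤-trans (m≤m+n m _) (n≤1+n _))))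
  values-adjacent (inU i) (inU i') e =
    conf-consecutive hu i i' (+-cancelˡ-≡ p _ _ (+-cancelˡ-≡ m _ _
      (trans (cong (m +_) (+-suc p _)) (trans (+-suc m _) e))))
  values-adjacent (inB j) (inB j') e = back-then-back j j' (+-cancelˡ-≡ m _ _ (trans (+-suc m _) e))
  values-adjacent (inB j) (inU i) e = back-then-rear j i (+-cancelˡ-≡ m _ _ (trans (+-suc m _) e))
  values-adjacent (inU i) (inA i') e =
    ⊥-elim (<⇒≱ (toℕ<n i') (subst (m ≤_) e (≤-trans (m≤m+n m _) (n≤1+n _))))
  values-adjacent (inU i) (inB j) e =
    ⊥-elim (<⇒≱ (+-monoʳ-< m (toℕ<n j))
                (≤-trans (+-monoʳ-≤ m (m≤m+n p _)) (≤-trans (n≤1+n _) (≤-reflexive e))))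

  in-range : ∀ {y} → y ≤ m + p + m → y < m + (p + suc m)
  in-range y≤ = ≤-<-trans (≤-trans y≤ (≤-reflexive (+-assoc m p m)))
                          (+-monoʳ-< m (+-monoʳ-< p (n<1+n m)))

  word-steps : ∀ x → x < m + p + m → Adj G (word x) (word (suc x))
  word-steps x x<end =
    subst₂ (Adj G) (sym (word-value bx)) (sym (word-value bx+1)) (values-adjacent bx bx+1 refl)
    where
    bx : Block x
    bx = block x (in-range (<⇒≤ x<end))
    bx+1 : Block (suc x)
    bx+1 = block (suc x) (in-range x<end)

  word-fresh : ∀ x y → x < y → y ≤ x + m → y ≤ m + p + m → word x ≢ word y
  word-fresh x y x<y near y≤end e =
    values-differ bx by x<y near (trans (sym (word-value bx)) (trans e (word-value by)))
    where
    bx : Block x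
    bx = block x (in-range (≤-trans (<⇒≤ x<y) y≤end))
    by : Block y
    by = block y (in-range y≤end)

  window-rear : window G m word (m + p) ≗ u
  window-rear i = trans (cong word (+-assoc m p (toℕ i))) (word-value (inU i))

  window-front : window G m word 0 ≗ a
  window-front i with lastOrInner i
  ... | inner i₀ = trans (cong word (toℕ-inject₁ i₀)) (word-value (inA i₀))
  ... | last     = begin
    word (toℕ (fromℕ m))  ≡⟨ cong word position ⟩
    word (m + toℕ first)  ≡⟨ word-value (inB first) ⟩
    back first            ≡⟨ back-first first (toℕ-fromℕ< 0<p) ⟩
    a (fromℕ m)           ∎
    where
    first : Fin p
    first = fromℕ< 0<p
    position : toℕ (fromℕ m) ≡ m + toℕ first
    position = trans (toℕ-fromℕ m)
                     (trans (sym (+-identityʳ m)) (cong (m +_) (sym (toℕ-fromℕ< 0<p))))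
    open ≡-Reasoning

  snake-reaches : CanReach G m u a
  snake-reaches = CanReach-resp window-rear window-front
                    (window-reach (m + p) (≤-trans 0<m (m≤m+n m p)) ≤-refl)
    where open Windows {G} word (m + p) word-steps word-fresh

-- Lemma 5.5.
lemma5p5 : (G : Graph) (m : ℕ)
    → (init fin : Tuple G (suc m)) → IsConf G m init → IsConf G m fin
    → (u a : Tuple G (suc m)) → IsConf G m u → IsConf G m a
    → (p : ℕ) (v : Fin (suc p) → Vertex G)
    → PathOrCycleOfSizeAtLeast G (suc m) p v
    → v zero ≡ u zero
    → v (fromℕ p) ≡ a (fromℕ m)
    → (∀ (i : Fin m) (j : Fin p) → u (suc i) ≢ v (suc j))
    → (∀ (i : Fin m) (j : Fin p) → a (inject₁ i) ≢ v (inject₁ j))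
    → CanReach G m u a
lemma5p5 G zero    _ _ _ _ u a hu ha p v track start end hU hA = single-vertex-move hu ha
lemma5p5 G (suc m) _ _ _ _ u a hu ha p v track start end hU hA =
  SnakeWord.snake-reaches (s≤s z≤n) track hu ha start end hU hA
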